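{- For every positive integer $n$, the $n\times n$ magog matrices having no entry equal to $-1$ are exactly the permutation matrices of the $132$-avoiding permutations of $\{1,\dots,n\}$.
   Context: An $n\times n$ magog matrix is an $n\times n$ matrix $A=(a_{ij})$ with entries in $\{0,1,-1\}$ such that all row sums and all column sums equal $1$, $0\le \sum_{i'=1}^{i}a_{i'j}\le 1$ for all $1\le i,j\le n$, $\sum_{j'=1}^{j}a_{ij'}\ge 0$ for all $1\le i,j\le n$, and for all $1\le i\le n-2$, $1\le j\le n-2$, $$\sum_{j'=1}^{j}a_{i+1,j'}+\sum_{i'=1}^{i+1}a_{i',j+1}-\sum_{i'=1}^{i}a_{i'j}\ge 0.$$ The permutation matrix of a permutation $\pi=\pi_1\cdots\pi_n$ is the $n\times n$ matrix $M$ with $M_{ij}=1$ if $\pi_i=j$ and $M_{ij}=0$ otherwise. A permutation $\pi$ contains a $132$ pattern if there are indices $i<j<k$ with $\pi_i<\pi_k<\pi_j$; it is $132$-avoiding otherwise. -}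

module Defs where

open import Data.Nat using (ℕ; zero; suc; _<_; _≤_; _∸_)
open import Data.Nat.Properties using (_<?_)
open import Data.Fin using (Fin; toℕ; fromℕ<)
open import Data.Fin.Permutation using (Permutation′; _⟨$⟩ʳ_)
open import Data.Integer using (ℤ; +_; -[1+_]; _+_; _-_; _≤_)
open import Data.Product using (_×_)
open import Data.Sum using (_⊎_)
open import Relation.Binary.PropositionalEquality using (_≡_; _≢_)
open import Relation.Nullary using (¬_; yes; no)

Matrix : ℕ → Set
Matrix n = Fin n → Fin n → ℤ

-- 1-based entry access a_{ij} for i,j ∈ {1,…,n}; returns 0 outside the range
-- (only ever used inside the range below).
entry : ∀ {n} → Matrix n → ℕ → ℕ → ℤ
entry {n} A zero _ = + 0
entry {n} A _ zero = + 0
entry {n} A (suc i) (suc j) with i <? n | j <? n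
... | yes p | yes q = A (fromℕ< p) (fromℕ< q)
... | _ | _ = + 0

rowSum : ∀ {n} → Matrix n → ℕ → ℕ → ℤ
rowSum A i zero = + 0
rowSum A i (suc j) = rowSum A i j + entry A i (suc j)

colSum : ∀ {n} → Matrix n → ℕ → ℕ → ℤ
colSum A zero j = + 0
colSum A (suc i) j = colSum A i j + entry A (suc i) j

-1ℤ : ℤ
-1ℤ = -[1+ 0 ]

InRange : ℕ → ℕ → Set
InRange n i = 1 Data.Nat.≤ i × i Data.Nat.≤ n

-- Magog matrix (1-based indices as in the paper).
record IsMagog (n : ℕ) (A : Matrix n) : Set where
  field
    entries   : ∀ i j → A i j ≡ + 0 ⊎ (A i j ≡ + 1 ⊎ A i j ≡ -1ℤ)
    rowSums   : ∀ i → InRange n i → rowSum A i n ≡ + 1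
    colSums   : ∀ j → InRange n j → colSum A n j ≡ + 1
    colPartLo : ∀ i j → InRange n i → InRange n j → + 0 Data.Integer.≤ colSum A i j
    colPartHi : ∀ i j → InRange n i → InRange n j → colSum A i j Data.Integer.≤ + 1
    rowPart   : ∀ i j → InRange n i → InRange n j → + 0 Data.Integer.≤ rowSum A i j
    extra     : ∀ i j → InRange (n ∸ 2) i → InRange (n ∸ 2) j →
                + 0 Data.Integer.≤
                  (rowSum A (suc i) j + colSum A (suc i) (suc j) - colSum A i j)

NoMinusOne : ∀ {n} → Matrix n → Set
NoMinusOne {n} A = ∀ (i j : Fin n) → A i j ≢ -1ℤ

permMatrix : ∀ {n} → Permutation′ n → Matrix n
permMatrix π i j with toℕ (π ⟨$⟩ʳ i) Data.Nat.≟ toℕ j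
... | yes _ = + 1
... | no _ = + 0

Contains132 : ∀ {n} → Permutation′ n → Set
Contains132 {n} π =
  Data.Product.∃ λ (i : Fin n) → Data.Product.∃ λ (j : Fin n) → Data.Product.∃ λ (k : Fin n) →
    (toℕ i < toℕ j) × (toℕ j < toℕ k) ×
    (toℕ (π ⟨$⟩ʳ i) < toℕ (π ⟨$⟩ʳ k)) × (toℕ (π ⟨$⟩ʳ k) < toℕ (π ⟨$⟩ʳ j))

Avoids132 : ∀ {n} → Permutation′ n → Set
Avoids132 π = ¬ Contains132 π

_≐_ : ∀ {n} → Matrix n → Matrix n → Set
_≐_ {n} A B = ∀ (i j : Fin n) → A i j ≡ B i j

-- A magog matrix without −1 entries is a 0/1 matrix whose rows and columns all sum to 1,
-- that is, a permutation matrix. For the permutation matrix of π every partial sum is an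
-- indicator, and the last magog inequality at (i, j) reads
-- [π(i+1) ≤ j] + [π⁻¹(j+1) ≤ i+1] − [π⁻¹(j) ≤ i] ≥ 0. It fails exactly when
-- π⁻¹(j) < i+1 < π⁻¹(j+1) and π(i+1) > j+1: a 132 pattern whose "1" and "2" are
-- consecutive values. Any 132 pattern π(a) < π(c) < π(b) yields such an adjacent one:
-- among the values from π(a) to π(c) there is a w occurring left of b with w+1 not
-- occurring left of b.
module Submission where

open import Defs
open import Data.Nat
  using (ℕ; zero; suc; _<_; _≤_; _∸_; _≥_; z≤n; s≤s; _≟_; _<?_)
open import Data.Nat.Properties
  using (≤-trans; ≤-<-trans; <-asym; <-irrefl; <⇒≤; <⇒≱; ≮⇒≥; ≤∧≢⇒<; ≤-pred;
         n<1+n; m<n⇒m<1+n; m<1+n⇒m<n∨m≡n; m+1+n≢0; m+n≤o⇒m≤o∸n;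
         +-comm; +-cancelʳ-≡)
open import Data.Integer as ℤ using (ℤ; +_; _+_; _-_; +≤+)
open import Data.Integer.Properties using (+-injective; +-identityʳ; +-mono-≤)
open import Data.Fin using (Fin; toℕ; fromℕ<)
open import Data.Fin.Properties using (toℕ<n; toℕ-fromℕ<; toℕ-injective; any?)
open import Data.Fin.Permutation using (Permutation′; _⟨$⟩ʳ_; _⟨$⟩ˡ_; inverseˡ; inverseʳ; permutation)
open import Data.Product using (_×_; _,_; ∃)
open import Data.Sum using (_⊎_; inj₁; inj₂)
open import Data.Empty using (⊥-elim)
open import Function using (_∘_)
open import Function.Bundles using (_⇔_; mk⇔; Inverse)
open import Relation.Nullary using (¬_; Dec; yes; no; contradiction)
open import Relation.Nullary.Decidable using (_×-dec_)
open import Relation.Unary using (Pred; Decidable)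
open import Relation.Binary.PropositionalEquality using (_≡_; _≢_; refl; sym; trans; cong; cong₂; subst; subst₂)

Binary : ℤ → Set
Binary x = x ≡ + 0 ⊎ x ≡ + 1

binary-nonneg : ∀ {x} → Binary x → + 0 ℤ.≤ x
binary-nonneg (inj₁ refl) = +≤+ z≤n
binary-nonneg (inj₂ refl) = +≤+ z≤n

binary-≤1 : ∀ {x} → Binary x → x ℤ.≤ + 1
binary-≤1 (inj₁ refl) = +≤+ z≤n
binary-≤1 (inj₂ refl) = +≤+ (s≤s z≤n)

+-≡0-split : ∀ {s x} → + 0 ℤ.≤ s → Binary x → s + x ≡ + 0 → s ≡ + 0 × x ≡ + 0
+-≡0-split {+ a} _ (inj₁ refl) s+x≡0 = trans (sym (+-identityʳ (+ a))) s+x≡0 , refl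
+-≡0-split {+ a} _ (inj₂ refl) s+x≡0 = ⊥-elim (m+1+n≢0 a (+-injective s+x≡0))

+-≡1-split : ∀ {s x} → + 0 ℤ.≤ s → Binary x → s + x ≡ + 1 →
             (s ≡ + 1 × x ≡ + 0) ⊎ (s ≡ + 0 × x ≡ + 1)
+-≡1-split {+ a} _ (inj₁ refl) s+x≡1 = inj₁ (trans (sym (+-identityʳ (+ a))) s+x≡1 , refl)
+-≡1-split {+ a} _ (inj₂ refl) s+x≡1 = inj₂ (cong +_ (+-cancelʳ-≡ 1 a 0 (+-injective s+x≡1)) , refl)

𝟙 : ∀ {p} {P : Set p} → Dec P → ℤ
𝟙 (yes _) = + 1
𝟙 (no _)  = + 0

module _ {p} {P : Set p} where

  𝟙-yes : (d : Dec P) → P → 𝟙 d ≡ + 1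
  𝟙-yes (yes _) _  = refl
  𝟙-yes (no ¬p) p′ = contradiction p′ ¬p

  𝟙-no : (d : Dec P) → ¬ P → 𝟙 d ≡ + 0
  𝟙-no (yes p′) ¬p = contradiction p′ ¬p
  𝟙-no (no _)   _  = refl

  𝟙-binary : (d : Dec P) → Binary (𝟙 d)
  𝟙-binary (yes _) = inj₂ refl
  𝟙-binary (no _)  = inj₁ refl

  𝟙-cong : ∀ {q} {Q : Set q} → (P → Q) → (Q → P) → (d : Dec P) (e : Dec Q) → 𝟙 d ≡ 𝟙 e
  𝟙-cong _ _ (yes _) (yes _) = refl
  𝟙-cong _ _ (no _)  (no _)  = refl
  𝟙-cong P⇒Q _ (yes p′) (no ¬q) = contradiction (P⇒Q p′) ¬q
  𝟙-cong _ Q⇒P (no ¬p) (yes q)  = contradiction (Q⇒P q) ¬p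

module _ {p q r} {P : Set p} {Q : Set q} {R : Set r} where

  𝟙+𝟙-𝟙-nonneg : (d : Dec P) (e : Dec Q) (f : Dec R) → (R → P ⊎ Q) →
                 + 0 ℤ.≤ 𝟙 d + 𝟙 e - 𝟙 f
  𝟙+𝟙-𝟙-nonneg (yes _) (yes _) (yes _) _ = +≤+ z≤n
  𝟙+𝟙-𝟙-nonneg (yes _) (yes _) (no _)  _ = +≤+ z≤n
  𝟙+𝟙-𝟙-nonneg (yes _) (no _)  (yes _) _ = +≤+ z≤n
  𝟙+𝟙-𝟙-nonneg (yes _) (no _)  (no _)  _ = +≤+ z≤n
  𝟙+𝟙-𝟙-nonneg (no _)  (yes _) (yes _) _ = +≤+ z≤n
  𝟙+𝟙-𝟙-nonneg (no _)  (yes _) (no _)  _ = +≤+ z≤n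
  𝟙+𝟙-𝟙-nonneg (no _)  (no _)  (no _)  _ = +≤+ z≤n
  𝟙+𝟙-𝟙-nonneg (no ¬p) (no ¬q) (yes r′) R⇒P⊎Q with R⇒P⊎Q r′
  ... | inj₁ p′ = contradiction p′ ¬p
  ... | inj₂ q′ = contradiction q′ ¬q

  𝟙+𝟙-𝟙-negative : (d : Dec P) (e : Dec Q) (f : Dec R) → R → ¬ P → ¬ Q →
                   ¬ (+ 0 ℤ.≤ 𝟙 d + 𝟙 e - 𝟙 f)
  𝟙+𝟙-𝟙-negative (yes p′) _ _ _ ¬p _ = contradiction p′ ¬p
  𝟙+𝟙-𝟙-negative (no _) (yes q′) _ _ _ ¬q = contradiction q′ ¬q
  𝟙+𝟙-𝟙-negative (no _) (no _) (no ¬r) r′ _ _ = contradiction r′ ¬r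
  𝟙+𝟙-𝟙-negative (no _) (no _) (yes _) _ _ _ ()

prefixSum : (ℕ → ℤ) → ℕ → ℤ
prefixSum g zero    = + 0
prefixSum g (suc m) = prefixSum g m + g (suc m)

𝟙<-suc : ∀ c m → 𝟙 (c <? m) + 𝟙 (c ≟ m) ≡ 𝟙 (c <? suc m)
𝟙<-suc c m with c <? m | c ≟ m | c <? suc m
... | yes c<m  | yes refl | _         = contradiction c<m (<-irrefl refl)
... | yes _    | no _     | yes _     = refl
... | yes c<m  | no _     | no c≮1+m  = contradiction (m<n⇒m<1+n c<m) c≮1+m
... | no _     | yes _    | yes _     = refl
... | no _     | yes refl | no c≮1+c  = contradiction (n<1+n c) c≮1+c
... | no c≮m   | no c≢m   | yes c<1+m = contradiction (≤∧≢⇒< (≤-pred c<1+m) c≢m) c≮m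
... | no _     | no _     | no _      = refl

prefixSum-point : ∀ {g c} → (∀ k → g (suc k) ≡ 𝟙 (c ≟ k)) → ∀ m → prefixSum g m ≡ 𝟙 (c <? m)
prefixSum-point {c = c} _ zero = sym (𝟙-no (c <? 0) λ ())
prefixSum-point {g} {c} g≡point (suc m) =
  trans (cong₂ _+_ (prefixSum-point g≡point m) (g≡point m)) (𝟙<-suc c m)

module _ {g : ℕ → ℤ} (binary : ∀ k → Binary (g k)) where

  prefixSum-nonneg : ∀ m → + 0 ℤ.≤ prefixSum g m
  prefixSum-nonneg zero    = +≤+ z≤n
  prefixSum-nonneg (suc m) = +-mono-≤ (prefixSum-nonneg m) (binary-nonneg (binary (suc m)))

  prefixSum-≡0 : ∀ m → prefixSum g m ≡ + 0 → ∀ {k} → k < m → g (suc k) ≡ + 0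
  prefixSum-≡0 (suc m) sum≡0 k<1+m
    with +-≡0-split (prefixSum-nonneg m) (binary (suc m)) sum≡0 | m<1+n⇒m<n∨m≡n k<1+m
  ... | init≡0 , _ | inj₁ k<m  = prefixSum-≡0 m init≡0 k<m
  ... | _ , last≡0 | inj₂ refl = last≡0

  prefixSum-≡1 : ∀ m → prefixSum g m ≡ + 1 →
    ∃ λ t → t < m × g (suc t) ≡ + 1 × (∀ {k} → k < m → g (suc k) ≡ + 1 → k ≡ t)
  prefixSum-≡1 (suc m) sum≡1
    with +-≡1-split (prefixSum-nonneg m) (binary (suc m)) sum≡1
  ... | inj₁ (init≡1 , last≡0) with prefixSum-≡1 m init≡1
  ...   | t , t<m , gt≡1 , unique = t , m<n⇒m<1+n t<m , gt≡1 , unique′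
    where
    unique′ : ∀ {k} → k < suc m → g (suc k) ≡ + 1 → k ≡ t
    unique′ k<1+m gk≡1 with m<1+n⇒m<n∨m≡n k<1+m
    ... | inj₁ k<m  = unique k<m gk≡1
    ... | inj₂ refl = contradiction (trans (sym gk≡1) last≡0) λ ()
  prefixSum-≡1 (suc m) sum≡1 | inj₂ (init≡0 , last≡1) = m , n<1+n m , last≡1 , unique
    where
    unique : ∀ {k} → k < suc m → g (suc k) ≡ + 1 → k ≡ m
    unique k<1+m gk≡1 with m<1+n⇒m<n∨m≡n k<1+m
    ... | inj₁ k<m = contradiction (trans (sym gk≡1) (prefixSum-≡0 m init≡0 k<m)) λ ()
    ... | inj₂ k≡m = k≡m

record ExactlyOne {n : ℕ} (v : Fin n → ℤ) : Set where
  field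
    position    : Fin n
    at-position : v position ≡ + 1
    unique      : ∀ j → v j ≡ + 1 → j ≡ position

open ExactlyOne

prefixSum-≡1⇒exactlyOne : ∀ {n g} (v : Fin n → ℤ) → (∀ k → Binary (g k)) →
  (∀ j → g (suc (toℕ j)) ≡ v j) → prefixSum g n ≡ + 1 → ExactlyOne v
prefixSum-≡1⇒exactlyOne {n} {g} v binary g≡v sum≡1 with prefixSum-≡1 binary n sum≡1
... | t , t<n , gt≡1 , unique-t = record
  { position    = fromℕ< t<n
  ; at-position = trans (sym (g≡v (fromℕ< t<n))) (subst (λ k → g (suc k) ≡ + 1) (sym (toℕ-fromℕ< t<n)) gt≡1)
  ; unique      = λ j vj≡1 → toℕ-injective
      (trans (unique-t (toℕ<n j) (trans (g≡v j) vj≡1)) (sym (toℕ-fromℕ< t<n)))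
  }

prefixSum-unit : ∀ {n g} (c : Fin n) → (∀ j → g (suc (toℕ j)) ≡ 𝟙 (toℕ c ≟ toℕ j)) →
  (∀ {k} → n ≤ k → g (suc k) ≡ + 0) → ∀ m → prefixSum g m ≡ 𝟙 (toℕ c <? m)
prefixSum-unit {n} {g} c inside outside = prefixSum-point point
  where
  point : ∀ k → g (suc k) ≡ 𝟙 (toℕ c ≟ k)
  point k with k <? n
  ... | yes k<n = subst (λ k → g (suc k) ≡ 𝟙 (toℕ c ≟ k)) (toℕ-fromℕ< k<n) (inside (fromℕ< k<n))
  ... | no k≮n  = trans (outside (≮⇒≥ k≮n))
                        (sym (𝟙-no _ λ c≡k → k≮n (subst (_< n) c≡k (toℕ<n c))))

module _ {n} (A : Matrix n) where

  entry-toℕ : (r c : Fin n) → entry A (suc (toℕ r)) (suc (toℕ c)) ≡ A r c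
  entry-toℕ r c with toℕ r <? n | toℕ c <? n
  ... | yes r<n | yes c<n = cong₂ A (toℕ-injective (toℕ-fromℕ< r<n)) (toℕ-injective (toℕ-fromℕ< c<n))
  ... | no r≮n | _        = contradiction (toℕ<n r) r≮n
  ... | yes _  | no c≮n   = contradiction (toℕ<n c) c≮n

  entry-outside : ∀ {i j} → n ≤ i ⊎ n ≤ j → entry A (suc i) (suc j) ≡ + 0
  entry-outside {i} {j} outside with i <? n | j <? n | outside
  ... | yes i<n | _       | inj₁ n≤i = contradiction n≤i (<⇒≱ i<n)
  ... | yes _   | yes j<n | inj₂ n≤j = contradiction n≤j (<⇒≱ j<n)
  ... | yes _   | no _    | _        = refl
  ... | no _    | _       | _        = refl

  entry-binary : (∀ r c → Binary (A r c)) → ∀ i j → Binary (entry A i j)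
  entry-binary _ zero    _       = inj₁ refl
  entry-binary _ (suc _) zero    = inj₁ refl
  entry-binary binary (suc i) (suc j) with i <? n | j <? n
  ... | yes _ | yes _ = binary _ _
  ... | yes _ | no _  = inj₁ refl
  ... | no _  | _     = inj₁ refl

  rowSum≡prefixSum : ∀ i m → rowSum A i m ≡ prefixSum (entry A i) m
  rowSum≡prefixSum i zero    = refl
  rowSum≡prefixSum i (suc m) = cong (_+ entry A i (suc m)) (rowSum≡prefixSum i m)

  colSum≡prefixSum : ∀ m j → colSum A m j ≡ prefixSum (λ i → entry A i j) m
  colSum≡prefixSum zero    j = refl
  colSum≡prefixSum (suc m) j = cong (_+ entry A (suc m) j) (colSum≡prefixSum m j)

inRange⇒suc-toℕ : ∀ {n i} → InRange n i → ∃ λ (r : Fin n) → suc (toℕ r) ≡ i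
inRange⇒suc-toℕ {i = suc i} (_ , i<n) = fromℕ< i<n , cong suc (toℕ-fromℕ< i<n)

0<m≤n∸2⇒1+m<n : ∀ {m n} → 1 ≤ m → m ≤ n ∸ 2 → suc m < n
0<m≤n∸2⇒1+m<n {n = suc (suc n)} (s≤s z≤n) m≤n = s≤s (s≤s m≤n)

m<n<o⇒m≤o∸2 : ∀ {m n o} → m < n → n < o → m ≤ o ∸ 2
m<n<o⇒m≤o∸2 {m} {n} {o} m<n n<o =
  m+n≤o⇒m≤o∸n m (subst (_≤ o) (+-comm 2 m) (≤-trans (s≤s m<n) n<o))

magogExtra : ∀ {n} → Matrix n → ℕ → ℕ → ℤ
magogExtra A i j = rowSum A (suc i) j + colSum A (suc i) (suc j) - colSum A i j

permMatrix-𝟙 : ∀ {n} (π : Permutation′ n) (r c : Fin n) →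
  permMatrix π r c ≡ 𝟙 (toℕ (π ⟨$⟩ʳ r) ≟ toℕ c)
permMatrix-𝟙 π r c with toℕ (π ⟨$⟩ʳ r) ≟ toℕ c
... | yes _ = refl
... | no _  = refl

module _ {n} {A : Matrix n} {π : Permutation′ n} (A≐π : A ≐ permMatrix π) where

  permMatrix-binary : ∀ r c → Binary (A r c)
  permMatrix-binary r c = subst Binary (sym (trans (A≐π r c) (permMatrix-𝟙 π r c))) (𝟙-binary _)

  rowSum-permMatrix : (r : Fin n) → ∀ m → rowSum A (suc (toℕ r)) m ≡ 𝟙 (toℕ (π ⟨$⟩ʳ r) <? m)
  rowSum-permMatrix r m = trans (rowSum≡prefixSum A _ m) (prefixSum-unit (π ⟨$⟩ʳ r) inside outside m)
    where
    inside : ∀ j → entry A (suc (toℕ r)) (suc (toℕ j)) ≡ 𝟙 (toℕ (π ⟨$⟩ʳ r) ≟ toℕ j)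
    inside j = trans (entry-toℕ A r j) (trans (A≐π r j) (permMatrix-𝟙 π r j))
    outside : ∀ {k} → n ≤ k → entry A (suc (toℕ r)) (suc k) ≡ + 0
    outside n≤k = entry-outside A (inj₂ n≤k)

  colSum-permMatrix : (c : Fin n) → ∀ m → colSum A m (suc (toℕ c)) ≡ 𝟙 (toℕ (π ⟨$⟩ˡ c) <? m)
  colSum-permMatrix c m = trans (colSum≡prefixSum A m _) (prefixSum-unit (π ⟨$⟩ˡ c) inside outside m)
    where
    inside : ∀ j → entry A (suc (toℕ j)) (suc (toℕ c)) ≡ 𝟙 (toℕ (π ⟨$⟩ˡ c) ≟ toℕ j)
    inside j = trans (entry-toℕ A j c) (trans (A≐π j c) (trans (permMatrix-𝟙 π j c)
      (𝟙-cong (λ πj≡c → cong toℕ (Inverse.inverseʳ π (sym (toℕ-injective πj≡c))))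
              (λ π⁻¹c≡j → cong toℕ (Inverse.inverseˡ π (sym (toℕ-injective π⁻¹c≡j))))
              _ _)))
    outside : ∀ {k} → n ≤ k → entry A (suc k) (suc (toℕ c)) ≡ + 0
    outside n≤k = entry-outside A (inj₁ n≤k)

  magogExtra-permMatrix : (r c c′ : Fin n) → toℕ c′ ≡ suc (toℕ c) →
    magogExtra A (toℕ r) (toℕ c′) ≡
      𝟙 (toℕ (π ⟨$⟩ʳ r) <? toℕ c′) + 𝟙 (toℕ (π ⟨$⟩ˡ c′) <? suc (toℕ r)) - 𝟙 (toℕ (π ⟨$⟩ˡ c) <? toℕ r)
  magogExtra-permMatrix r c c′ c′≡1+c =
    cong₂ _-_ (cong₂ _+_ (rowSum-permMatrix r (toℕ c′)) (colSum-permMatrix c′ (suc (toℕ r))))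
              (trans (cong (colSum A (toℕ r)) c′≡1+c) (colSum-permMatrix c (toℕ r)))

  permMatrix-magogExtra-nonneg : Avoids132 π → (r c c′ : Fin n) → toℕ c′ ≡ suc (toℕ c) →
    + 0 ℤ.≤ magogExtra A (toℕ r) (toℕ c′)
  permMatrix-magogExtra-nonneg avoids r c c′ c′≡1+c =
    subst (+ 0 ℤ.≤_) (sym (magogExtra-permMatrix r c c′ c′≡1+c)) (𝟙+𝟙-𝟙-nonneg (toℕ (π ⟨$⟩ʳ r) <? toℕ c′) (toℕ (π ⟨$⟩ˡ c′) <? suc (toℕ r))
                                      (toℕ (π ⟨$⟩ˡ c) <? toℕ r) no-pattern)
    where
    no-pattern : toℕ (π ⟨$⟩ˡ c) < toℕ r →
      toℕ (π ⟨$⟩ʳ r) < toℕ c′ ⊎ toℕ (π ⟨$⟩ˡ c′) < suc (toℕ r)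
    no-pattern π⁻¹c<r with toℕ (π ⟨$⟩ʳ r) <? toℕ c′ | toℕ (π ⟨$⟩ˡ c′) <? suc (toℕ r)
    ... | yes πr<c′ | _          = inj₁ πr<c′
    ... | no _      | yes π⁻¹c′≤r = inj₂ π⁻¹c′≤r
    ... | no πr≮c′  | no π⁻¹c′≰r =
      contradiction (π ⟨$⟩ˡ c , r , π ⟨$⟩ˡ c′ , π⁻¹c<r , r<π⁻¹c′ , c<c′ , c′<πr) avoids
      where
      r<π⁻¹c′ : toℕ r < toℕ (π ⟨$⟩ˡ c′)
      r<π⁻¹c′ = ≮⇒≥ π⁻¹c′≰r
      c<c′ : toℕ (π ⟨$⟩ʳ (π ⟨$⟩ˡ c)) < toℕ (π ⟨$⟩ʳ (π ⟨$⟩ˡ c′))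
      c<c′ rewrite inverseʳ π {c} | inverseʳ π {c′} | c′≡1+c = n<1+n (toℕ c)
      c′≢πr : toℕ c′ ≢ toℕ (π ⟨$⟩ʳ r)
      c′≢πr c′≡πr = <-irrefl (cong toℕ (sym (Inverse.inverseʳ π (toℕ-injective c′≡πr)))) r<π⁻¹c′
      c′<πr : toℕ (π ⟨$⟩ʳ (π ⟨$⟩ˡ c′)) < toℕ (π ⟨$⟩ʳ r)
      c′<πr rewrite inverseʳ π {c′} = ≤∧≢⇒< (≮⇒≥ πr≮c′) c′≢πr

  permMatrix⇒noMinusOne : NoMinusOne A
  permMatrix⇒noMinusOne r c Arc≡-1 with permMatrix-binary r c
  ... | inj₁ Arc≡0 = contradiction (trans (sym Arc≡-1) Arc≡0) λ ()
  ... | inj₂ Arc≡1 = contradiction (trans (sym Arc≡-1) Arc≡1) λ ()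

  permMatrix⇒magog : Avoids132 π → IsMagog n A
  permMatrix⇒magog avoids = record
    { entries   = λ r c → entries (permMatrix-binary r c)
    ; rowSums   = rowSums
    ; colSums   = colSums
    ; colPartLo = λ i j _ j∈ → binary-nonneg (colSum-binary i j j∈)
    ; colPartHi = λ i j _ j∈ → binary-≤1 (colSum-binary i j j∈)
    ; rowPart   = rowPart
    ; extra     = extra
    }
    where
    entries : ∀ {x} → Binary x → x ≡ + 0 ⊎ (x ≡ + 1 ⊎ x ≡ -1ℤ)
    entries (inj₁ x≡0) = inj₁ x≡0
    entries (inj₂ x≡1) = inj₂ (inj₁ x≡1)

    rowSums : ∀ i → InRange n i → rowSum A i n ≡ + 1
    rowSums i i∈ with inRange⇒suc-toℕ i∈
    ... | r , refl = trans (rowSum-permMatrix r n) (𝟙-yes _ (toℕ<n _))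

    colSums : ∀ j → InRange n j → colSum A n j ≡ + 1
    colSums j j∈ with inRange⇒suc-toℕ j∈
    ... | c , refl = trans (colSum-permMatrix c n) (𝟙-yes _ (toℕ<n _))

    colSum-binary : ∀ i j → InRange n j → Binary (colSum A i j)
    colSum-binary i j j∈ with inRange⇒suc-toℕ j∈
    ... | c , refl = subst Binary (sym (colSum-permMatrix c i)) (𝟙-binary _)

    rowPart : ∀ i j → InRange n i → InRange n j → + 0 ℤ.≤ rowSum A i j
    rowPart i j i∈ _ with inRange⇒suc-toℕ i∈
    ... | r , refl = subst (+ 0 ℤ.≤_) (sym (rowSum-permMatrix r j)) (binary-nonneg (𝟙-binary _))

    extra : ∀ i j → InRange (n ∸ 2) i → InRange (n ∸ 2) j → + 0 ℤ.≤ magogExtra A i j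
    extra i (suc j) (1≤i , i≤n∸2) (_ , 1+j≤n∸2) =
      subst₂ (λ i j → + 0 ℤ.≤ magogExtra A i j) (toℕ-fromℕ< i<n) (toℕ-fromℕ< 1+j<n)
        (permMatrix-magogExtra-nonneg avoids (fromℕ< i<n) (fromℕ< j<n) (fromℕ< 1+j<n)
          (trans (toℕ-fromℕ< 1+j<n) (cong suc (sym (toℕ-fromℕ< j<n)))))
      where
      i<n : i < n
      i<n = <⇒≤ (0<m≤n∸2⇒1+m<n 1≤i i≤n∸2)
      1+j<n : suc j < n
      1+j<n = <⇒≤ (0<m≤n∸2⇒1+m<n (s≤s z≤n) 1+j≤n∸2)
      j<n : j < n
      j<n = <⇒≤ 1+j<n

crossing : ∀ {q} {Q : Pred ℕ q} → Decidable Q → ∀ {x y} → x ≤ y → Q x → ¬ Q y →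
           ∃ λ w → w < y × Q w × ¬ Q (suc w)
crossing Q? {y = zero} z≤n Qx ¬Qy = contradiction Qx ¬Qy
crossing Q? {x} {suc y} x≤1+y Qx ¬Q1+y with Q? y
... | yes Qy = y , n<1+n y , Qy , ¬Q1+y
... | no ¬Qy with m<1+n⇒m<n∨m≡n (s≤s x≤1+y)
...   | inj₂ refl = contradiction Qx ¬Q1+y
...   | inj₁ x<1+y with crossing Q? (≤-pred x<1+y) Qx ¬Qy
...     | w , w<y , Qw , ¬Q1+w = w , m<n⇒m<1+n w<y , Qw , ¬Q1+w

Adjacent132 : ∀ {n} → Permutation′ n → Set
Adjacent132 {n} π =
  ∃ λ (a : Fin n) → ∃ λ (b : Fin n) → ∃ λ (c : Fin n) →
    toℕ a < toℕ b × toℕ b < toℕ c ×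
    toℕ (π ⟨$⟩ʳ c) ≡ suc (toℕ (π ⟨$⟩ʳ a)) × toℕ (π ⟨$⟩ʳ c) < toℕ (π ⟨$⟩ʳ b)

contains132⇒adjacent132 : ∀ {n} (π : Permutation′ n) → Contains132 π → Adjacent132 π
contains132⇒adjacent132 {n} π (a , b , c , a<b , b<c , πa<πc , πc<πb) =
  adjacent (crossing occursBefore? (<⇒≤ πa<πc) (a , a<b , refl) ¬occursBefore-πc)
  where
  OccursBefore : ℕ → Set
  OccursBefore v = ∃ λ r → toℕ r < toℕ b × toℕ (π ⟨$⟩ʳ r) ≡ v

  occursBefore? : Decidable OccursBefore
  occursBefore? v = any? λ r → (toℕ r <? toℕ b) ×-dec (toℕ (π ⟨$⟩ʳ r) ≟ v)

  ¬occursBefore-πc : ¬ OccursBefore (toℕ (π ⟨$⟩ʳ c))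
  ¬occursBefore-πc (r , r<b , πr≡πc)
    with trans (sym (inverseˡ π)) (trans (cong (π ⟨$⟩ˡ_) (toℕ-injective πr≡πc)) (inverseˡ π))
  ... | refl = <-asym r<b b<c

  adjacent : (∃ λ w → w < toℕ (π ⟨$⟩ʳ c) × OccursBefore w × ¬ OccursBefore (suc w)) → Adjacent132 π
  adjacent (w , w<πc , (a′ , a′<b , πa′≡w) , ¬occursBefore-1+w) =
    a′ , b , c′ , a′<b , b<c′ , trans πc′≡1+w (cong suc (sym πa′≡w)) , πc′<πb
    where
    1+w<n : suc w < n
    1+w<n = ≤-<-trans w<πc (toℕ<n (π ⟨$⟩ʳ c))
    c′ : Fin n
    c′ = π ⟨$⟩ˡ fromℕ< 1+w<n
    πc′≡1+w : toℕ (π ⟨$⟩ʳ c′) ≡ suc w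
    πc′≡1+w = trans (cong toℕ (inverseʳ π)) (toℕ-fromℕ< 1+w<n)
    πc′<πb : toℕ (π ⟨$⟩ʳ c′) < toℕ (π ⟨$⟩ʳ b)
    πc′<πb = subst (_< toℕ (π ⟨$⟩ʳ b)) (sym πc′≡1+w) (≤-<-trans w<πc πc<πb)
    b≢c′ : toℕ b ≢ toℕ c′
    b≢c′ b≡c′ = <-irrefl (cong (toℕ ∘ (π ⟨$⟩ʳ_)) (toℕ-injective (sym b≡c′))) πc′<πb
    b<c′ : toℕ b < toℕ c′
    b<c′ = ≤∧≢⇒< (≮⇒≥ λ c′<b → ¬occursBefore-1+w (c′ , c′<b , πc′≡1+w)) b≢c′

binary-exactlyOne⇒permMatrix : ∀ {n} (A : Matrix n) → (∀ r c → Binary (A r c)) →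
  (∀ r → ExactlyOne (A r)) → (∀ c → ExactlyOne (λ r → A r c)) →
  ∃ λ (π : Permutation′ n) → A ≐ permMatrix π
binary-exactlyOne⇒permMatrix {n} A binary rowOne colOne = π , A≐π
  where
  π : Permutation′ n
  π = permutation (position ∘ rowOne) (position ∘ colOne)
        (λ c → sym (unique (rowOne (position (colOne c))) c (at-position (colOne c))))
        (λ r → sym (unique (colOne (position (rowOne r))) r (at-position (rowOne r))))

  A≐π : A ≐ permMatrix π
  A≐π r c = trans (A≡𝟙 (toℕ (position (rowOne r)) ≟ toℕ c)) (sym (permMatrix-𝟙 π r c))
    where
    A≡𝟙 : (d : Dec (toℕ (position (rowOne r)) ≡ toℕ c)) → A r c ≡ 𝟙 d
    A≡𝟙 (yes ≡c) = subst (λ c → A r c ≡ + 1) (toℕ-injective ≡c) (at-position (rowOne r))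
    A≡𝟙 (no ≢c) with binary r c
    ... | inj₁ Arc≡0 = Arc≡0
    ... | inj₂ Arc≡1 = contradiction (cong toℕ (sym (unique (rowOne r) c Arc≡1))) ≢c

module _ {n} {A : Matrix n} (magog : IsMagog n A) where
  open IsMagog magog

  magog-binary : NoMinusOne A → ∀ r c → Binary (A r c)
  magog-binary noMinusOne r c with entries r c
  ... | inj₁ Arc≡0         = inj₁ Arc≡0
  ... | inj₂ (inj₁ Arc≡1)  = inj₂ Arc≡1
  ... | inj₂ (inj₂ Arc≡-1) = contradiction Arc≡-1 (noMinusOne r c)

  magog⇒permMatrix : NoMinusOne A → ∃ λ (π : Permutation′ n) → A ≐ permMatrix π
  magog⇒permMatrix noMinusOne = binary-exactlyOne⇒permMatrix A binary rowOne colOne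
    where
    binary : ∀ r c → Binary (A r c)
    binary = magog-binary noMinusOne
    rowOne : ∀ r → ExactlyOne (A r)
    rowOne r = prefixSum-≡1⇒exactlyOne (A r) (entry-binary A binary _) (entry-toℕ A r)
      (trans (sym (rowSum≡prefixSum A _ n)) (rowSums _ (s≤s z≤n , toℕ<n r)))
    colOne : ∀ c → ExactlyOne (λ r → A r c)
    colOne c = prefixSum-≡1⇒exactlyOne (λ r → A r c) (λ k → entry-binary A binary k _) (λ r → entry-toℕ A r c)
      (trans (sym (colSum≡prefixSum A n _)) (colSums _ (s≤s z≤n , toℕ<n c)))

  magog⇒avoids132 : ∀ {π} → A ≐ permMatrix π → Avoids132 π
  magog⇒avoids132 {π} A≐π occurrence with contains132⇒adjacent132 π occurrence
  ... | a , b , c , a<b , b<c , πc≡1+πa , πc<πb =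
    𝟙+𝟙-𝟙-negative (toℕ (π ⟨$⟩ʳ b) <? toℕ (π ⟨$⟩ʳ c)) (toℕ (π ⟨$⟩ˡ (π ⟨$⟩ʳ c)) <? suc (toℕ b))
                    (toℕ (π ⟨$⟩ˡ (π ⟨$⟩ʳ a)) <? toℕ b) a<b′ (<-asym πc<πb) c≮1+b
      (subst (+ 0 ℤ.≤_) (magogExtra-permMatrix A≐π b (π ⟨$⟩ʳ a) (π ⟨$⟩ʳ c) πc≡1+πa)
        (extra (toℕ b) (toℕ (π ⟨$⟩ʳ c)) b∈ πc∈))
    where
    a<b′ : toℕ (π ⟨$⟩ˡ (π ⟨$⟩ʳ a)) < toℕ b
    a<b′ rewrite inverseˡ π {a} = a<b
    c≮1+b : ¬ (toℕ (π ⟨$⟩ˡ (π ⟨$⟩ʳ c)) < suc (toℕ b))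
    c≮1+b rewrite inverseˡ π {c} = <⇒≱ b<c ∘ ≤-pred
    b∈ : InRange (n ∸ 2) (toℕ b)
    b∈ = ≤-trans (s≤s z≤n) a<b , m<n<o⇒m≤o∸2 b<c (toℕ<n c)
    πc∈ : InRange (n ∸ 2) (toℕ (π ⟨$⟩ʳ c))
    πc∈ = subst (1 ≤_) (sym πc≡1+πa) (s≤s z≤n) , m<n<o⇒m≤o∸2 πc<πb (toℕ<n (π ⟨$⟩ʳ b))

theorem3p5 : (n : ℕ) → n ≥ 1 → (A : Matrix n) →
    (IsMagog n A × NoMinusOne A) ⇔ ∃ (λ (π : Permutation′ n) → Avoids132 π × (A ≐ permMatrix π))
theorem3p5 n _ A = mk⇔ toPermutation fromPermutation
  where
  toPermutation : IsMagog n A × NoMinusOne A → ∃ λ π → Avoids132 π × A ≐ permMatrix π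
  toPermutation (magog , noMinusOne) with magog⇒permMatrix magog noMinusOne
  ... | π , A≐π = π , magog⇒avoids132 magog A≐π , A≐π

  fromPermutation : (∃ λ π → Avoids132 π × A ≐ permMatrix π) → IsMagog n A × NoMinusOne A
  fromPermutation (π , avoids , A≐π) = permMatrix⇒magog A≐π avoids , permMatrix⇒noMinusOne A≐π
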